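{- Let $g$ be a positive integer, let $\mathcal{A}$ be a finite nonempty $g$-thin Sidon set of integers, and let $T$ be a positive integer. For $0\le s\le g$ let $D_s$ be the set of integers $r\in[1,T)$ that have exactly $s$ representations as $r=a-b$ with $(a,b)\in\mathcal{A}^2$. Then \[ \operatorname{diam}(\mathcal{A})=\frac{|\mathcal{A}|^2T^2}{gT(T-1)+|\mathcal{A}|T-\bigl(2S_g(\mathcal{A},T)+V(\mathcal{A},T)\bigr)}-T, \] where $A_i^{(T)}=|\mathcal{A}\cap[i-T,i)|$, \[ S_g(\mathcal{A},T)=\sum_{s=0}^{g-1}\sum_{r\in D_s}(g-s)(T-r), \] and \[ V(\mathcal{A},T)=\sum_{i=\min(\mathcal{A})+1}^{T+\max(\mathcal{A})}\left(A_i^{(T)}-\frac{|\mathcal{A}|T}{T+\operatorname{diam}(\mathcal{A})}\right)^2. \]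
   Context: A set $\mathcal{A}$ of integers is a $g$-thin Sidon set if for every integer $d$, the number of pairs $(a,b)\in\mathcal{A}^2$ with $a\ne b$ and $a-b=d$ is at most $g$. For a finite set $\mathcal{A}$, $\operatorname{diam}(\mathcal{A})=\max\mathcal{A}-\min\mathcal{A}$. All intervals are intervals of integers, e.g. $[i-T,i)=\{i-T,\dots,i-1\}$. -}

module Defs where

open import Data.Nat as ℕ using (ℕ; zero; suc; _∸_)
open import Data.Integer as ℤ using (ℤ; +_; -[1+_])
open import Data.Rational as ℚ using (ℚ; 0ℚ)
open import Data.Nat.ListAction using (sum)
open import Data.List using (List; []; _∷_; length; filter; map; upTo; foldr; cartesianProduct)
open import Data.Product using (_×_; _,_; proj₁; proj₂)
open import Relation.Nullary using (¬?)
open import Relation.Nullary.Decidable using (_×-dec_)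

-- A finite set of integers is represented by a duplicate-free list
-- (duplicate-freeness is a hypothesis of the theorem).

pairs : List ℤ → List (ℤ × ℤ)
pairs A = cartesianProduct A A

repsNe : List ℤ → ℤ → ℕ
repsNe A d = length (filter (λ p → ¬? (proj₁ p ℤ.≟ proj₂ p) ×-dec (proj₁ p ℤ.- proj₂ p ℤ.≟ d)) (pairs A))

IsThinSidon : ℕ → List ℤ → Set
IsThinSidon g A = ∀ (d : ℤ) → repsNe A d ℕ.≤ g

reps : List ℤ → ℤ → ℕ
reps A r = length (filter (λ p → proj₁ p ℤ.- proj₂ p ℤ.≟ r) (pairs A))

-- min / max of a (nonempty) list; value on [] is irrelevant
minℤ : List ℤ → ℤ
minℤ [] = + 0
minℤ (x ∷ xs) = foldr ℤ._⊓_ x xs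

maxℤ : List ℤ → ℤ
maxℤ [] = + 0
maxℤ (x ∷ xs) = foldr ℤ._⊔_ x xs

diam : List ℤ → ℤ
diam A = maxℤ A ℤ.- minℤ A

countWin : List ℤ → ℤ → ℕ → ℕ
countWin A i T = length (filter (λ a → (i ℤ.- + T ℤ.≤? a) ×-dec (a ℤ.<? i)) A)

range1 : ℕ → List ℕ
range1 T = map suc (upTo (T ∸ 1))

Dset : List ℤ → ℕ → ℕ → List ℕ
Dset A T s = filter (λ r → reps A (+ r) ℕ.≟ s) (range1 T)

-- S_g(A,T) = Σ_{s=0}^{g-1} Σ_{r ∈ D_s} (g - s)(T - r)   (s < g, r < T so ∸ is exact)
Sg : ℕ → List ℤ → ℕ → ℕ
Sg g A T = sum (map (λ s → sum (map (λ r → (g ∸ s) ℕ.* (T ∸ r)) (Dset A T s))) (upTo g))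

clamp : ℤ → ℕ
clamp (+ n) = n
clamp -[1+ n ] = 0

intervalℤ : ℤ → ℤ → List ℤ
intervalℤ lo hi = map (λ k → lo ℤ.+ + k) (upTo (clamp ((hi ℤ.+ + 1) ℤ.- lo)))

-- n / d in ℚ; the d = 0 case never occurs under the theorem's hypotheses
divℕ : ℤ → ℕ → ℚ
divℕ n zero = 0ℚ
divℕ n (suc d) = n ℚ./ suc d

ℕ→ℚ : ℕ → ℚ
ℕ→ℚ n = + n ℚ./ 1

sumℚ : List ℚ → ℚ
sumℚ = foldr ℚ._+_ 0ℚ

V : List ℤ → ℕ → ℚ
V A T = sumℚ (map (λ i → let x = ℕ→ℚ (countWin A i T) ℚ.- μ in x ℚ.* x)
                  (intervalℤ (minℤ A ℤ.+ + 1) (+ T ℤ.+ maxℤ A)))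
  where
  μ : ℚ
  μ = divℕ (+ (length A ℕ.* T)) (T ℕ.+ clamp (diam A))

denom : ℕ → List ℤ → ℕ → ℚ
denom g A T = ℕ→ℚ (g ℕ.* T ℕ.* (T ∸ 1) ℕ.+ length A ℕ.* T)
              ℚ.- (ℕ→ℚ (2 ℕ.* Sg g A T) ℚ.+ V A T)

{-# OPTIONS --safe #-}
module Submission where

-- Translate A to K = A - min A ⊆ [0, D], D = diam A.  For i = min A + 1 + k the window count
-- A_i^{(T)} is the number of j ∈ K with k ∈ [j, j + T), and the T + D windows meeting A are
-- k ∈ [0, T + D).  Summing, Σ A_i = |A| T; expanding the square,
-- Σ A_i² = Σ_{a,b ∈ A} |[a, a + T) ∩ [b, b + T)| = |A| T + 2 Σ_{r=1}^{T-1} ρ(r) (T - r),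
-- where ρ(r) counts the representations r = a - b.  As ρ(r) ≤ g, grouping S_g by the value
-- of ρ gives S_g = Σ_{r=1}^{T-1} (g - ρ(r)) (T - r), so 2 S_g + Σ A_i² = g T (T - 1) + |A| T.
-- With μ = |A| T / (T + D), V = Σ A_i² - (T + D) μ², so the denominator is
-- (T + D) μ² = |A|² T² / (T + D), which is the formula solved for D.

open import Data.Bool.Base using (true; false; if_then_else_)
open import Data.Empty using (⊥-elim)
open import Data.Nat as ℕ using (ℕ; zero; suc; _+_; _*_; _∸_; _⊓_; _≤_; _<_; z<s; s≤s)
open import Data.Nat.Properties
open import Data.Nat.ListAction using (sum)
open import Data.Nat.ListAction.Properties using (sum-++)
open import Data.Nat.Tactic.RingSolver using (solve-∀)
open import Algebra.Properties.CommutativeSemigroup +-commutativeSemigroup using (interchange)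
open import Data.List using (List; []; _∷_; _++_; [_]; length; map; filter; upTo; cartesianProduct)
open import Data.List.Properties using (map-++; map-cong; map-cong-local; map-∘; map-id-local; length-map; upTo-∷ʳ; length-upTo; map-upTo; map-applyUpTo)
open import Data.List.Membership.Propositional using (_∈_)
open import Data.List.Membership.Propositional.Properties using (∈-map⁻)
open import Data.List.Relation.Unary.All as All using (All; []; _∷_)
open import Data.List.Relation.Unary.Any using (here; there)
open import Data.List.Relation.Unary.Unique.Propositional using (Unique; _∷_)
import Data.List.Relation.Unary.Unique.Propositional.Properties as UP
open import Data.Product using (_×_; _,_; proj₁; proj₂; Σ-syntax)
open import Relation.Nullary using (Dec; yes; no; does; ¬_; ¬?)
open import Relation.Nullary.Decidable using (_×-dec_; dec⇒maybe)
open import Relation.Binary.PropositionalEquality hiding ([_])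
open import Relation.Binary.Definitions using (tri<; tri≈; tri>)
open import Function using (_∘_)
open import Data.Integer as ℤ using (ℤ; 0ℤ)
import Data.Integer.Properties as ℤP
open import Data.Integer.Tactic.RingSolver using () renaming (solve-∀ to ℤ-solve-∀)
import Data.List.Relation.Unary.All.Properties as AllP
open import Data.Rational as ℚ using (ℚ; 0ℚ; 1ℚ)
import Data.Rational.Properties as ℚP
open import Data.Rational.Unnormalised as ℚᵘ using (ℚᵘ; mkℚᵘ; *≡*)
import Data.Rational.Unnormalised.Properties as ℚᵘP
open import Level using (0ℓ)
import Tactic.RingSolver.Core.AlmostCommutativeRing as ACR
open import Tactic.RingSolver using () renaming (solve-∀ to ring-solve-∀)
open import Defs

-- Finite sums and indicators

∑ : {X : Set} → List X → (X → ℕ) → ℕ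
∑ xs f = sum (map f xs)

syntax ∑ xs (λ x → e) = ∑[ x ∈ xs ] e

𝟙 : {P : Set} → Dec P → ℕ
𝟙 p = if does p then 1 else 0

𝟙-yes : ∀ {P : Set} (p : Dec P) → P → 𝟙 p ≡ 1
𝟙-yes (yes _) _ = refl
𝟙-yes (no ¬x) x = ⊥-elim (¬x x)

𝟙-no : ∀ {P : Set} (p : Dec P) → ¬ P → 𝟙 p ≡ 0
𝟙-no (yes x) ¬x = ⊥-elim (¬x x)
𝟙-no (no _) _ = refl

module _ {P Q : Set} where

  𝟙-cong : (p : Dec P) (q : Dec Q) → (P → Q) → (Q → P) → 𝟙 p ≡ 𝟙 q
  𝟙-cong (yes x) q P→Q _ = sym (𝟙-yes q (P→Q x))
  𝟙-cong (no ¬x) q _ Q→P = sym (𝟙-no q (λ y → ¬x (Q→P y)))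

  𝟙-× : (p : Dec P) (q : Dec Q) → 𝟙 (p ×-dec q) ≡ 𝟙 p * 𝟙 q
  𝟙-× (yes _) (yes _) = refl
  𝟙-× (yes _) (no _) = refl
  𝟙-× (no _) _ = refl

module _ {X : Set} where

  ∑-cong : ∀ (xs : List X) {f g : X → ℕ} → (∀ x → f x ≡ g x) → ∑ xs f ≡ ∑ xs g
  ∑-cong xs f≗g = cong sum (map-cong f≗g xs)

  ∑-cong-∈ : ∀ {xs : List X} {f g : X → ℕ} → (∀ {x} → x ∈ xs → f x ≡ g x) → ∑ xs f ≡ ∑ xs g
  ∑-cong-∈ f≗g = cong sum (map-cong-local (All.tabulate f≗g))

  ∑-+ : ∀ (xs : List X) (f g : X → ℕ) → ∑[ x ∈ xs ] (f x + g x) ≡ ∑ xs f + ∑ xs g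
  ∑-+ [] f g = refl
  ∑-+ (x ∷ xs) f g = trans (cong ((f x + g x) +_) (∑-+ xs f g)) (interchange (f x) (g x) _ _)

  ∑-*ˡ : ∀ (xs : List X) (c : ℕ) (f : X → ℕ) → ∑[ x ∈ xs ] (c * f x) ≡ c * ∑ xs f
  ∑-*ˡ [] c f = sym (*-zeroʳ c)
  ∑-*ˡ (x ∷ xs) c f = trans (cong (c * f x +_) (∑-*ˡ xs c f)) (sym (*-distribˡ-+ c (f x) _))

  ∑-*ʳ : ∀ (xs : List X) (c : ℕ) (f : X → ℕ) → ∑[ x ∈ xs ] (f x * c) ≡ ∑ xs f * c
  ∑-*ʳ xs c f = trans (∑-cong xs (λ x → *-comm (f x) c)) (trans (∑-*ˡ xs c f) (*-comm c _))

  ∑-const : ∀ (xs : List X) (c : ℕ) → ∑[ _ ∈ xs ] c ≡ length xs * c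
  ∑-const [] c = refl
  ∑-const (x ∷ xs) c = cong (c +_) (∑-const xs c)

  ∑-zero : ∀ (xs : List X) → ∑[ _ ∈ xs ] 0 ≡ 0
  ∑-zero xs = trans (∑-const xs 0) (*-zeroʳ (length xs))

  ∑-++ : ∀ (xs ys : List X) (f : X → ℕ) → ∑ (xs ++ ys) f ≡ ∑ xs f + ∑ ys f
  ∑-++ xs ys f = trans (cong sum (map-++ f xs ys)) (sum-++ (map f xs) (map f ys))

  module _ {P : X → Set} (P? : ∀ x → Dec (P x)) where

    length-filter≡∑𝟙 : ∀ xs → length (filter P? xs) ≡ ∑[ x ∈ xs ] 𝟙 (P? x)
    length-filter≡∑𝟙 [] = refl
    length-filter≡∑𝟙 (x ∷ xs) with does (P? x)
    ... | true = cong suc (length-filter≡∑𝟙 xs)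
    ... | false = length-filter≡∑𝟙 xs

    ∑-filter : ∀ xs (f : X → ℕ) → ∑ (filter P? xs) f ≡ ∑[ x ∈ xs ] (𝟙 (P? x) * f x)
    ∑-filter [] f = refl
    ∑-filter (x ∷ xs) f with does (P? x)
    ... | true = cong₂ _+_ (sym (+-identityʳ (f x))) (∑-filter xs f)
    ... | false = ∑-filter xs f

module _ {X Y : Set} where

  ∑-map : ∀ (xs : List X) (h : X → Y) (f : Y → ℕ) → ∑ (map h xs) f ≡ ∑[ x ∈ xs ] f (h x)
  ∑-map xs h f = cong sum (sym (map-∘ xs))

  ∑-swap : ∀ (xs : List X) (ys : List Y) (f : X → Y → ℕ) →
           ∑[ x ∈ xs ] ∑[ y ∈ ys ] f x y ≡ ∑[ y ∈ ys ] ∑[ x ∈ xs ] f x y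
  ∑-swap [] ys f = sym (∑-zero ys)
  ∑-swap (x ∷ xs) ys f = trans (cong (∑ ys (f x) +_) (∑-swap xs ys f)) (sym (∑-+ ys (f x) _))

  ∑-*-∑ : ∀ (xs : List X) (ys : List Y) (f : X → ℕ) (g : Y → ℕ) →
          ∑ xs f * ∑ ys g ≡ ∑[ x ∈ xs ] ∑[ y ∈ ys ] (f x * g y)
  ∑-*-∑ xs ys f g = trans (sym (∑-*ʳ xs (∑ ys g) f)) (∑-cong xs (λ x → sym (∑-*ˡ ys (f x) g)))

∑-cartesianProduct : ∀ {X Y : Set} (xs : List X) (ys : List Y) (f : X × Y → ℕ) →
                     ∑ (cartesianProduct xs ys) f ≡ ∑[ x ∈ xs ] ∑[ y ∈ ys ] f (x , y)
∑-cartesianProduct [] ys f = refl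
∑-cartesianProduct (x ∷ xs) ys f = begin
  ∑ (map (x ,_) ys ++ cartesianProduct xs ys) f       ≡⟨ ∑-++ (map (x ,_) ys) _ f ⟩
  ∑ (map (x ,_) ys) f + ∑ (cartesianProduct xs ys) f  ≡⟨ cong₂ _+_ (∑-map ys (x ,_) f) (∑-cartesianProduct xs ys f) ⟩
  ∑[ y ∈ ys ] f (x , y) + ∑[ x ∈ xs ] ∑[ y ∈ ys ] f (x , y) ∎
  where open ≡-Reasoning

∑-upTo-sucˡ : ∀ n (f : ℕ → ℕ) → ∑ (upTo (suc n)) f ≡ f 0 + ∑[ k ∈ upTo n ] f (suc k)
∑-upTo-sucˡ n f = cong (f 0 +_) (cong sum (trans (map-applyUpTo suc f n) (sym (map-upTo (f ∘ suc) n))))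

∑-upTo-sucʳ : ∀ n (f : ℕ → ℕ) → ∑ (upTo (suc n)) f ≡ ∑ (upTo n) f + f n
∑-upTo-sucʳ n f = begin
  ∑ (upTo (suc n)) f        ≡⟨ cong (λ ks → ∑ ks f) (upTo-∷ʳ n) ⟨
  ∑ (upTo n ++ [ n ]) f     ≡⟨ ∑-++ (upTo n) [ n ] f ⟩
  ∑ (upTo n) f + (f n + 0)  ≡⟨ cong (∑ (upTo n) f +_) (+-identityʳ (f n)) ⟩
  ∑ (upTo n) f + f n        ∎
  where open ≡-Reasoning

gauss : ∀ n → 2 * ∑[ k ∈ upTo n ] (n ∸ k) ≡ suc n * n
gauss zero = refl
gauss (suc n) = begin
  2 * ∑[ k ∈ upTo (suc n) ] (suc n ∸ k)   ≡⟨ cong (2 *_) (∑-upTo-sucˡ n (suc n ∸_)) ⟩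
  2 * (suc n + ∑[ k ∈ upTo n ] (n ∸ k))   ≡⟨ *-distribˡ-+ 2 (suc n) _ ⟩
  2 * suc n + 2 * ∑[ k ∈ upTo n ] (n ∸ k) ≡⟨ cong (2 * suc n +_) (gauss n) ⟩
  2 * suc n + suc n * n                   ≡⟨ expand n ⟩
  suc (suc n) * suc n                     ∎
  where
  open ≡-Reasoning
  expand : ∀ n → 2 * suc n + suc n * n ≡ suc (suc n) * suc n
  expand = solve-∀

∑-upTo-δ : ∀ n d (h : ℕ → ℕ) → ∑[ k ∈ upTo n ] (𝟙 (d ≟ k) * h k) ≡ 𝟙 (d <? n) * h d
∑-upTo-δ zero d h = refl
∑-upTo-δ (suc n) d h = begin
  ∑[ k ∈ upTo (suc n) ] (𝟙 (d ≟ k) * h k)               ≡⟨ ∑-upTo-sucʳ n _ ⟩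
  ∑[ k ∈ upTo n ] (𝟙 (d ≟ k) * h k) + 𝟙 (d ≟ n) * h n  ≡⟨ cong (_+ 𝟙 (d ≟ n) * h n) (∑-upTo-δ n d h) ⟩
  𝟙 (d <? n) * h d + 𝟙 (d ≟ n) * h n                   ≡⟨ last-term ⟩
  𝟙 (d <? suc n) * h d                                  ∎
  where
  open ≡-Reasoning
  last-term : 𝟙 (d <? n) * h d + 𝟙 (d ≟ n) * h n ≡ 𝟙 (d <? suc n) * h d
  last-term with <-cmp d n
  ... | tri< d<n d≢n _
    rewrite 𝟙-yes (d <? n) d<n | 𝟙-no (d ≟ n) d≢n | 𝟙-yes (d <? suc n) (m<n⇒m<1+n d<n) = +-identityʳ _
  ... | tri≈ d≮n refl _
    rewrite 𝟙-no (d <? d) d≮n | 𝟙-yes (d ≟ d) refl | 𝟙-yes (d <? suc d) (n<1+n d) = refl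
  ... | tri> d≮n d≢n n<d
    rewrite 𝟙-no (d <? n) d≮n | 𝟙-no (d ≟ n) d≢n | 𝟙-no (d <? suc n) (λ d<1+n → <⇒≱ n<d (≤-pred d<1+n)) = refl

∑-δ-unique : ∀ {ks : List ℕ} → Unique ks → ∀ {j} → j ∈ ks → ∑[ k ∈ ks ] 𝟙 (j ≟ k) ≡ 1
∑-δ-unique {j ∷ ks} (j∉ks ∷ _) (here refl) rewrite 𝟙-yes (j ≟ j) refl =
  cong suc (trans (∑-cong-∈ (λ k∈ks → 𝟙-no (j ≟ _) (All.lookup j∉ks k∈ks))) (∑-zero ks))
∑-δ-unique {k ∷ ks} (k∉ks ∷ unique) {j} (there j∈ks) rewrite 𝟙-no (j ≟ k) (λ { refl → All.lookup k∉ks j∈ks refl }) =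
  ∑-δ-unique unique j∈ks

∑-diagonal : ∀ {ks : List ℕ} → Unique ks → ∀ c → ∑[ j ∈ ks ] ∑[ k ∈ ks ] (𝟙 (j ≟ k) * c) ≡ length ks * c
∑-diagonal {ks} unique c = begin
  ∑[ j ∈ ks ] ∑[ k ∈ ks ] (𝟙 (j ≟ k) * c)  ≡⟨ ∑-cong ks (λ j → ∑-*ʳ ks c (λ k → 𝟙 (j ≟ k))) ⟩
  ∑[ j ∈ ks ] (∑[ k ∈ ks ] 𝟙 (j ≟ k) * c)  ≡⟨ ∑-cong-∈ (λ j∈ks → cong (_* c) (∑-δ-unique unique j∈ks)) ⟩
  ∑[ _ ∈ ks ] (1 * c)                        ≡⟨ ∑-const ks (1 * c) ⟩
  length ks * (1 * c)                        ≡⟨ cong (length ks *_) (*-identityˡ c) ⟩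
  length ks * c                              ∎
  where open ≡-Reasoning

𝟙<*∸ : ∀ d n → 𝟙 (d <? n) * (n ∸ d) ≡ n ∸ d
𝟙<*∸ d n with d <? n
... | yes d<n rewrite 𝟙-yes (d <? n) d<n = +-identityʳ (n ∸ d)
... | no d≮n rewrite 𝟙-no (d <? n) d≮n = sym (m≤n⇒m∸n≡0 (≮⇒≥ d≮n))

∑-∸-+ : ∀ {X : Set} (xs : List X) {g : ℕ} (ρ w : X → ℕ) → (∀ {x} → x ∈ xs → ρ x ≤ g) →
        ∑[ x ∈ xs ] ((g ∸ ρ x) * w x) + ∑[ x ∈ xs ] (ρ x * w x) ≡ g * ∑ xs w
∑-∸-+ xs {g} ρ w ρ≤g = begin
  ∑[ x ∈ xs ] ((g ∸ ρ x) * w x) + ∑[ x ∈ xs ] (ρ x * w x)  ≡⟨ ∑-+ xs _ _ ⟨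
  ∑[ x ∈ xs ] ((g ∸ ρ x) * w x + ρ x * w x)                ≡⟨ ∑-cong-∈ (λ x∈ → trans (sym (*-distribʳ-+ (w _) (g ∸ ρ _) (ρ _)))
                                                                                 (cong (_* w _) (m∸n+n≡m (ρ≤g x∈)))) ⟩
  ∑[ x ∈ xs ] (g * w x)                                     ≡⟨ ∑-*ˡ xs g w ⟩
  g * ∑ xs w                                                ∎
  where open ≡-Reasoning

∑-by-value : ∀ {X : Set} (g : ℕ) (ρ : X → ℕ) (rs : List X) (f : ℕ → X → ℕ) →
             ∑[ s ∈ upTo g ] ∑[ r ∈ filter (λ r → ρ r ≟ s) rs ] f s r ≡ ∑[ r ∈ rs ] (𝟙 (ρ r <? g) * f (ρ r) r)
∑-by-value g ρ rs f = begin
  ∑[ s ∈ upTo g ] ∑[ r ∈ filter (λ r → ρ r ≟ s) rs ] f s r  ≡⟨ ∑-cong (upTo g) (λ s → ∑-filter (λ r → ρ r ≟ s) rs (f s)) ⟩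
  ∑[ s ∈ upTo g ] ∑[ r ∈ rs ] (𝟙 (ρ r ≟ s) * f s r)        ≡⟨ ∑-swap (upTo g) rs _ ⟩
  ∑[ r ∈ rs ] ∑[ s ∈ upTo g ] (𝟙 (ρ r ≟ s) * f s r)        ≡⟨ ∑-cong rs (λ r → ∑-upTo-δ g (ρ r) (λ s → f s r)) ⟩
  ∑[ r ∈ rs ] (𝟙 (ρ r <? g) * f (ρ r) r)                   ∎
  where open ≡-Reasoning

-- Windows

between : ℕ → ℕ → ℕ → ℕ
between lo hi k = 𝟙 ((lo ≤? k) ×-dec (k <? hi))

∑-between : ∀ L lo hi → ∑[ k ∈ upTo L ] between lo hi k ≡ (hi ⊓ L) ∸ lo
∑-between zero lo hi = trans (sym (0∸n≡0 lo)) (cong (_∸ lo) (sym (⊓-zeroʳ hi)))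
∑-between (suc L) lo hi = begin
  ∑[ k ∈ upTo (suc L) ] between lo hi k              ≡⟨ ∑-upTo-sucʳ L _ ⟩
  ∑[ k ∈ upTo L ] between lo hi k + between lo hi L  ≡⟨ cong (_+ between lo hi L) (∑-between L lo hi) ⟩
  (hi ⊓ L) ∸ lo + between lo hi L                    ≡⟨ cong ((hi ⊓ L) ∸ lo +_) (𝟙-× (lo ≤? L) (L <? hi)) ⟩
  (hi ⊓ L) ∸ lo + 𝟙 (lo ≤? L) * 𝟙 (L <? hi)          ≡⟨ last-point ⟩
  (hi ⊓ suc L) ∸ lo                                  ∎
  where
  open ≡-Reasoning
  last-point : (hi ⊓ L) ∸ lo + 𝟙 (lo ≤? L) * 𝟙 (L <? hi) ≡ (hi ⊓ suc L) ∸ lo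
  last-point with L <? hi
  ... | no L≮hi
    rewrite m≤n⇒m⊓n≡m (≮⇒≥ L≮hi) | m≤n⇒m⊓n≡m (m≤n⇒m≤1+n (≮⇒≥ L≮hi)) | 𝟙-no (L <? hi) L≮hi
          | *-zeroʳ (𝟙 (lo ≤? L)) = +-identityʳ _
  ... | yes L<hi
    rewrite m≥n⇒m⊓n≡n (<⇒≤ L<hi) | m≥n⇒m⊓n≡n L<hi | 𝟙-yes (L <? hi) L<hi | *-identityʳ (𝟙 (lo ≤? L)) with lo ≤? L
  ...   | yes lo≤L rewrite 𝟙-yes (lo ≤? L) lo≤L = trans (+-comm (L ∸ lo) 1) (sym (+-∸-assoc 1 lo≤L))
  ...   | no lo≰L rewrite 𝟙-no (lo ≤? L) lo≰L =
          trans (+-identityʳ _) (trans (m≤n⇒m∸n≡0 (<⇒≤ (≰⇒> lo≰L))) (sym (m≤n⇒m∸n≡0 (≰⇒> lo≰L))))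

∑-window : ∀ {L} T {j} → j + T ≤ L → ∑[ k ∈ upTo L ] between j (j + T) k ≡ T
∑-window {L} T {j} j+T≤L = trans (∑-between L j (j + T)) (trans (cong (_∸ j) (m≤n⇒m⊓n≡m j+T≤L)) (m+n∸m≡n j T))

between-*-between : ∀ {lo hi lo' hi'} → lo ≤ lo' → hi ≤ hi' →
                    ∀ k → between lo hi k * between lo' hi' k ≡ between lo' hi k
between-*-between {lo} {hi} {lo'} {hi'} lo≤lo' hi≤hi' k = begin
  between lo hi k * between lo' hi' k                           ≡⟨ 𝟙-× ((lo ≤? k) ×-dec (k <? hi)) ((lo' ≤? k) ×-dec (k <? hi')) ⟨
  𝟙 (((lo ≤? k) ×-dec (k <? hi)) ×-dec ((lo' ≤? k) ×-dec (k <? hi')))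
    ≡⟨ 𝟙-cong (((lo ≤? k) ×-dec (k <? hi)) ×-dec ((lo' ≤? k) ×-dec (k <? hi'))) ((lo' ≤? k) ×-dec (k <? hi))
              (λ { ((_ , k<hi) , (lo'≤k , _)) → lo'≤k , k<hi })
              (λ { (lo'≤k , k<hi) → (≤-trans lo≤lo' lo'≤k , k<hi) , (lo'≤k , <-≤-trans k<hi hi≤hi') }) ⟩
  between lo' hi k                                              ∎
  where open ≡-Reasoning

∑-window-overlap : ∀ {L} T {j j'} → j ≤ j' → j + T ≤ L →
                   ∑[ k ∈ upTo L ] (between j (j + T) k * between j' (j' + T) k) ≡ j + T ∸ j'
∑-window-overlap {L} T {j} {j'} j≤j' j+T≤L = begin
  ∑[ k ∈ upTo L ] (between j (j + T) k * between j' (j' + T) k)  ≡⟨ ∑-cong (upTo L) (between-*-between j≤j' (+-monoˡ-≤ T j≤j')) ⟩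
  ∑[ k ∈ upTo L ] between j' (j + T) k                            ≡⟨ ∑-between L j' (j + T) ⟩
  ((j + T) ⊓ L) ∸ j'                                              ≡⟨ cong (_∸ j') (m≤n⇒m⊓n≡m j+T≤L) ⟩
  j + T ∸ j'                                                      ∎
  where open ≡-Reasoning

-- |[j, j + T) ∩ [j', j' + T)| when j' < j
overlapBelow : ℕ → ℕ → ℕ → ℕ
overlapBelow T j j' = 𝟙 (j' <? j) * (j' + T ∸ j)

∑-window-overlap-split : ∀ {L} T j j' → j + T ≤ L → j' + T ≤ L →
  ∑[ k ∈ upTo L ] (between j (j + T) k * between j' (j' + T) k)
    ≡ 𝟙 (j ≟ j') * T + overlapBelow T j j' + overlapBelow T j' j
∑-window-overlap-split {L} T j j' j+T≤L j'+T≤L with <-cmp j j'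
... | tri< j<j' j≢j' _
  rewrite 𝟙-no (j ≟ j') j≢j' | 𝟙-no (j' <? j) (<⇒≯ j<j') | 𝟙-yes (j <? j') j<j' =
  trans (∑-window-overlap T (<⇒≤ j<j') j+T≤L) (sym (+-identityʳ _))
... | tri≈ _ refl _
  rewrite 𝟙-yes (j ≟ j) refl | 𝟙-no (j <? j) (n≮n j) =
  trans (∑-window-overlap T ≤-refl j+T≤L) (trans (m+n∸m≡n j T) (sym (trans (+-identityʳ _) (trans (+-identityʳ _) (+-identityʳ T)))))
... | tri> _ j≢j' j'<j
  rewrite 𝟙-no (j ≟ j') j≢j' | 𝟙-yes (j' <? j) j'<j | 𝟙-no (j <? j') (<⇒≯ j'<j) =
  trans (∑-cong (upTo L) (λ k → *-comm (between j (j + T) k) _))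
        (trans (∑-window-overlap T (<⇒≤ j'<j) j'+T≤L) (sym (trans (+-identityʳ _) (+-identityʳ _))))

-- For A = map (shift (min A)) K this is A_i^{(T)} at i = min A + 1 + k (countWin-shift).
cover : ℕ → List ℕ → ℕ → ℕ
cover T K k = ∑[ j ∈ K ] between j (j + T) k

module _ (T D : ℕ) {K : List ℕ} (K≤D : All (_≤ D) K) where

  private
    window⊆ : ∀ {j} → j ∈ K → j + T ≤ T + D
    window⊆ j∈K = ≤-trans (+-monoˡ-≤ T (All.lookup K≤D j∈K)) (≤-reflexive (+-comm D T))

  ∑-cover : ∑[ k ∈ upTo (T + D) ] cover T K k ≡ length K * T
  ∑-cover = begin
    ∑[ k ∈ upTo (T + D) ] ∑[ j ∈ K ] between j (j + T) k  ≡⟨ ∑-swap (upTo (T + D)) K _ ⟩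
    ∑[ j ∈ K ] ∑[ k ∈ upTo (T + D) ] between j (j + T) k  ≡⟨ ∑-cong-∈ (λ j∈K → ∑-window T (window⊆ j∈K)) ⟩
    ∑[ _ ∈ K ] T                                         ≡⟨ ∑-const K T ⟩
    length K * T                                         ∎
    where open ≡-Reasoning

  ∑-cover² : Unique K → ∑[ k ∈ upTo (T + D) ] (cover T K k * cover T K k)
                          ≡ length K * T + 2 * ∑[ j ∈ K ] ∑[ j' ∈ K ] overlapBelow T j j'
  ∑-cover² unique = begin
    ∑[ k ∈ upTo (T + D) ] (cover T K k * cover T K k)
      ≡⟨ ∑-cong (upTo (T + D)) (λ k → ∑-*-∑ K K (λ j → between j (j + T) k) (λ j' → between j' (j' + T) k)) ⟩
    ∑[ k ∈ upTo (T + D) ] ∑[ j ∈ K ] ∑[ j' ∈ K ] (between j (j + T) k * between j' (j' + T) k)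
      ≡⟨ ∑-swap (upTo (T + D)) K _ ⟩
    ∑[ j ∈ K ] ∑[ k ∈ upTo (T + D) ] ∑[ j' ∈ K ] (between j (j + T) k * between j' (j' + T) k)
      ≡⟨ ∑-cong K (λ j → ∑-swap (upTo (T + D)) K _) ⟩
    ∑[ j ∈ K ] ∑[ j' ∈ K ] ∑[ k ∈ upTo (T + D) ] (between j (j + T) k * between j' (j' + T) k)
      ≡⟨ ∑-cong-∈ (λ j∈K → ∑-cong-∈ (λ j'∈K → ∑-window-overlap-split T _ _ (window⊆ j∈K) (window⊆ j'∈K))) ⟩
    ∑[ j ∈ K ] ∑[ j' ∈ K ] (𝟙 (j ≟ j') * T + overlapBelow T j j' + overlapBelow T j' j)
      ≡⟨ ∑-cong K (λ j → ∑-+₃ K (λ j' → 𝟙 (j ≟ j') * T) (overlapBelow T j) (λ j' → overlapBelow T j' j)) ⟩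
    ∑[ j ∈ K ] (∑[ j' ∈ K ] (𝟙 (j ≟ j') * T) + ∑[ j' ∈ K ] overlapBelow T j j' + ∑[ j' ∈ K ] overlapBelow T j' j)
      ≡⟨ ∑-+₃ K _ _ _ ⟩
    ∑[ j ∈ K ] ∑[ j' ∈ K ] (𝟙 (j ≟ j') * T) + X + ∑[ j ∈ K ] ∑[ j' ∈ K ] overlapBelow T j' j
      ≡⟨ cong₂ (λ a b → a + X + b) (∑-diagonal unique T) (∑-swap K K (λ j j' → overlapBelow T j' j)) ⟩
    length K * T + X + X
      ≡⟨ +-assoc (length K * T) X X ⟩
    length K * T + (X + X)
      ≡⟨ cong (λ y → length K * T + (X + y)) (+-identityʳ X) ⟨
    length K * T + 2 * X
      ∎
    where
    open ≡-Reasoning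
    X : ℕ
    X = ∑[ j ∈ K ] ∑[ j' ∈ K ] overlapBelow T j j'
    ∑-+₃ : ∀ (xs : List ℕ) (f g h : ℕ → ℕ) → ∑[ x ∈ xs ] (f x + g x + h x) ≡ ∑ xs f + ∑ xs g + ∑ xs h
    ∑-+₃ xs f g h = trans (∑-+ xs _ h) (cong (_+ ∑ xs h) (∑-+ xs f g))

-- Representation counts

repsℕ : List ℕ → ℕ → ℕ
repsℕ K r = ∑[ j ∈ K ] ∑[ j' ∈ K ] 𝟙 (j ≟ j' + r)

overlapBelow-as-∑ : ∀ N j j' → overlapBelow (suc N) j j' ≡ ∑[ k ∈ upTo N ] (𝟙 (j ≟ j' + suc k) * (N ∸ k))
overlapBelow-as-∑ N j j' with j' <? j
... | no j'≮j rewrite 𝟙-no (j' <? j) j'≮j =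
  sym (trans (∑-cong (upTo N) (λ k → cong (_* (N ∸ k)) (𝟙-no (j ≟ j' + suc k) (λ { refl → j'≮j (m<m+n j' z<s) }))))
             (∑-zero (upTo N)))
... | yes j'<j with m≤n⇒∃[o]m+o≡n j'<j
...   | e , refl = begin
  𝟙 (j' <? suc j' + e) * (j' + suc N ∸ (suc j' + e))         ≡⟨ cong₂ _*_ (𝟙-yes (j' <? suc j' + e) j'<j) (cong (_∸ suc (j' + e)) (+-suc j' N)) ⟩
  1 * (suc (j' + N) ∸ suc (j' + e))                          ≡⟨ trans (*-identityˡ _) ([m+n]∸[m+o]≡n∸o j' N e) ⟩
  N ∸ e                                                      ≡⟨ 𝟙<*∸ e N ⟨
  𝟙 (e <? N) * (N ∸ e)                                       ≡⟨ ∑-upTo-δ N e (N ∸_) ⟨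
  ∑[ k ∈ upTo N ] (𝟙 (e ≟ k) * (N ∸ k))
    ≡⟨ ∑-cong (upTo N) (λ k → cong (_* (N ∸ k)) (𝟙-cong (e ≟ k) (suc j' + e ≟ j' + suc k) shift⇒ shift⇐)) ⟩
  ∑[ k ∈ upTo N ] (𝟙 (suc j' + e ≟ j' + suc k) * (N ∸ k))    ∎
  where
  open ≡-Reasoning
  shift⇒ : ∀ {k} → e ≡ k → suc j' + e ≡ j' + suc k
  shift⇒ refl = sym (+-suc j' e)
  shift⇐ : ∀ {k} → suc j' + e ≡ j' + suc k → e ≡ k
  shift⇐ {k} eq = +-cancelˡ-≡ j' e k (suc-injective (trans eq (+-suc j' k)))

∑-overlapBelow≡∑-reps : ∀ N (K : List ℕ) →
  ∑[ j ∈ K ] ∑[ j' ∈ K ] overlapBelow (suc N) j j' ≡ ∑[ r ∈ range1 (suc N) ] (repsℕ K r * (suc N ∸ r))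
∑-overlapBelow≡∑-reps N K = begin
  ∑[ j ∈ K ] ∑[ j' ∈ K ] overlapBelow (suc N) j j'
    ≡⟨ ∑-cong K (λ j → ∑-cong K (overlapBelow-as-∑ N j)) ⟩
  ∑[ j ∈ K ] ∑[ j' ∈ K ] ∑[ k ∈ upTo N ] (𝟙 (j ≟ j' + suc k) * (N ∸ k))
    ≡⟨ ∑-cong K (λ j → ∑-swap K (upTo N) _) ⟩
  ∑[ j ∈ K ] ∑[ k ∈ upTo N ] ∑[ j' ∈ K ] (𝟙 (j ≟ j' + suc k) * (N ∸ k))
    ≡⟨ ∑-swap K (upTo N) _ ⟩
  ∑[ k ∈ upTo N ] ∑[ j ∈ K ] ∑[ j' ∈ K ] (𝟙 (j ≟ j' + suc k) * (N ∸ k))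
    ≡⟨ ∑-cong (upTo N) (λ k → trans (∑-cong K (λ j → ∑-*ʳ K (N ∸ k) _)) (∑-*ʳ K (N ∸ k) _)) ⟩
  ∑[ k ∈ upTo N ] (repsℕ K (suc k) * (N ∸ k))
    ≡⟨ ∑-map (upTo N) suc (λ r → repsℕ K r * (suc N ∸ r)) ⟨
  ∑[ r ∈ range1 (suc N) ] (repsℕ K r * (suc N ∸ r))  ∎
  where open ≡-Reasoning

double-∑-range1 : ∀ N → 2 * ∑[ r ∈ range1 (suc N) ] (suc N ∸ r) ≡ suc N * N
double-∑-range1 N = trans (cong (2 *_) (∑-map (upTo N) suc (suc N ∸_))) (gauss N)

second-moment : ∀ g N D {K : List ℕ} → All (_≤ D) K → Unique K → (∀ {r} → r ∈ range1 (suc N) → repsℕ K r ≤ g) →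
  2 * ∑[ r ∈ range1 (suc N) ] ((g ∸ repsℕ K r) * (suc N ∸ r)) + ∑[ k ∈ upTo (suc N + D) ] (cover (suc N) K k * cover (suc N) K k)
    ≡ g * suc N * N + length K * suc N
second-moment g N D {K} K≤D unique reps≤g = begin
  2 * S + ∑[ k ∈ upTo (T + D) ] (cover T K k * cover T K k)  ≡⟨ cong (2 * S +_) (∑-cover² T D K≤D unique) ⟩
  2 * S + (length K * T + 2 * X)                             ≡⟨ regroup (length K * T) S X ⟩
  2 * (S + X) + length K * T                                 ≡⟨ cong (λ x → 2 * (S + x) + length K * T) (∑-overlapBelow≡∑-reps N K) ⟩
  2 * (S + ∑[ r ∈ R ] (ρ r * (T ∸ r))) + length K * T         ≡⟨ cong (λ s → 2 * s + length K * T) (∑-∸-+ R ρ (T ∸_) reps≤g) ⟩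
  2 * (g * ∑[ r ∈ R ] (T ∸ r)) + length K * T                 ≡⟨ cong (_+ length K * T) (*-comm-middle 2 g _) ⟩
  g * (2 * ∑[ r ∈ R ] (T ∸ r)) + length K * T                 ≡⟨ cong (λ s → g * s + length K * T) (double-∑-range1 N) ⟩
  g * (T * N) + length K * T                                  ≡⟨ cong (_+ length K * T) (*-assoc g T N) ⟨
  g * T * N + length K * T                                    ∎
  where
  open ≡-Reasoning
  T S X : ℕ
  T = suc N
  R : List ℕ
  R = range1 T
  ρ : ℕ → ℕ
  ρ = repsℕ K
  S = ∑[ r ∈ R ] ((g ∸ ρ r) * (T ∸ r))
  X = ∑[ j ∈ K ] ∑[ j' ∈ K ] overlapBelow T j j'
  regroup : ∀ c s x → 2 * s + (c + 2 * x) ≡ 2 * (s + x) + c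
  regroup = solve-∀
  *-comm-middle : ∀ a b c → a * (b * c) ≡ b * (a * c)
  *-comm-middle = solve-∀

-- Translating A to the origin

shift : ℤ → ℕ → ℤ
shift m k = m ℤ.+ ℤ.+ k

clamp-nonNeg : ∀ {z} → 0ℤ ℤ.≤ z → ℤ.+ clamp z ≡ z
clamp-nonNeg {ℤ.+ _} _ = refl

minℤ-≤ : ∀ A → All (minℤ A ℤ.≤_) A
minℤ-≤ [] = []
minℤ-≤ (x ∷ []) = ℤP.≤-refl ∷ []
minℤ-≤ (x ∷ y ∷ ys) with minℤ-≤ (x ∷ ys)
... | x≥ ∷ ys≥ = ℤP.≤-trans (ℤP.i⊓j≤j y _) x≥ ∷ ℤP.i⊓j≤i y _ ∷ All.map (ℤP.≤-trans (ℤP.i⊓j≤j y _)) ys≥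

≤-maxℤ : ∀ A → All (ℤ._≤ maxℤ A) A
≤-maxℤ [] = []
≤-maxℤ (x ∷ []) = ℤP.≤-refl ∷ []
≤-maxℤ (x ∷ y ∷ ys) with ≤-maxℤ (x ∷ ys)
... | x≤ ∷ ys≤ = ℤP.≤-trans x≤ (ℤP.i≤j⊔i y _) ∷ ℤP.i≤i⊔j y _ ∷ All.map (λ z≤ → ℤP.≤-trans z≤ (ℤP.i≤j⊔i y _)) ys≤

minℤ≤maxℤ : ∀ A → minℤ A ℤ.≤ maxℤ A
minℤ≤maxℤ [] = ℤP.≤-refl
minℤ≤maxℤ (x ∷ xs) = ℤP.≤-trans (All.head (minℤ-≤ (x ∷ xs))) (All.head (≤-maxℤ (x ∷ xs)))

shift-clamp-difference : ∀ {m a} → m ℤ.≤ a → shift m (clamp (a ℤ.- m)) ≡ a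
shift-clamp-difference {m} {a} m≤a = trans (cong (ℤ._+_ m) (clamp-nonNeg (ℤP.i≤j⇒0≤j-i m≤a))) (m+[a-m]≡a m a)
  where
  m+[a-m]≡a : ∀ m a → m ℤ.+ (a ℤ.- m) ≡ a
  m+[a-m]≡a = ℤ-solve-∀

offsets : List ℤ → List ℕ
offsets A = map (λ a → clamp (a ℤ.- minℤ A)) A

map-shift-offsets : ∀ A → map (shift (minℤ A)) (offsets A) ≡ A
map-shift-offsets A = trans (sym (map-∘ A)) (map-id-local (All.map shift-clamp-difference (minℤ-≤ A)))

offsets-≤-diam : ∀ A → All (_≤ clamp (diam A)) (offsets A)
offsets-≤-diam A = AllP.map⁺ (All.zipWith offset≤ (minℤ-≤ A , ≤-maxℤ A))
  where
  offset≤ : ∀ {a} → minℤ A ℤ.≤ a × a ℤ.≤ maxℤ A → clamp (a ℤ.- minℤ A) ≤ clamp (diam A)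
  offset≤ (m≤a , a≤M) = ℤP.drop‿+≤+ (subst₂ ℤ._≤_ (sym (clamp-nonNeg (ℤP.i≤j⇒0≤j-i m≤a)))
                                                  (sym (clamp-nonNeg (ℤP.i≤j⇒0≤j-i (minℤ≤maxℤ A))))
                                                  (ℤP.+-monoˡ-≤ (ℤ.- minℤ A) a≤M))

maxℤ≡shift-diam : ∀ A → maxℤ A ≡ shift (minℤ A) (clamp (diam A))
maxℤ≡shift-diam A = sym (shift-clamp-difference (minℤ≤maxℤ A))

shift-difference : ∀ m j j' r → shift m j ℤ.- shift m j' ≡ ℤ.+ r → j ≡ j' + r
shift-difference m j j' r eq = trans (ℤP.+-injective (trans (sym (cancel m (ℤ.+ j) (ℤ.+ j'))) (cong (ℤ._+ ℤ.+ j') eq))) (+-comm r j')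
  where
  cancel : ∀ m x y → (m ℤ.+ x) ℤ.- (m ℤ.+ y) ℤ.+ y ≡ x
  cancel = ℤ-solve-∀

shift-difference⁻ : ∀ m j' r → shift m (j' + r) ℤ.- shift m j' ≡ ℤ.+ r
shift-difference⁻ m j' r = cancel m (ℤ.+ j') (ℤ.+ r)
  where
  cancel : ∀ m x y → (m ℤ.+ (x ℤ.+ y)) ℤ.- (m ℤ.+ x) ≡ y
  cancel = ℤ-solve-∀

reps-shift : ∀ m K r → reps (map (shift m) K) (ℤ.+ r) ≡ repsℕ K r
reps-shift m K r = begin
  reps (map (shift m) K) (ℤ.+ r)
    ≡⟨ length-filter≡∑𝟙 (λ p → proj₁ p ℤ.- proj₂ p ℤ.≟ ℤ.+ r) (pairs (map (shift m) K)) ⟩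
  ∑[ p ∈ pairs (map (shift m) K) ] 𝟙 (proj₁ p ℤ.- proj₂ p ℤ.≟ ℤ.+ r)
    ≡⟨ ∑-cartesianProduct (map (shift m) K) (map (shift m) K) _ ⟩
  ∑[ a ∈ map (shift m) K ] ∑[ b ∈ map (shift m) K ] 𝟙 (a ℤ.- b ℤ.≟ ℤ.+ r)
    ≡⟨ trans (∑-map K (shift m) _) (∑-cong K (λ j → ∑-map K (shift m) _)) ⟩
  ∑[ j ∈ K ] ∑[ j' ∈ K ] 𝟙 (shift m j ℤ.- shift m j' ℤ.≟ ℤ.+ r)
    ≡⟨ ∑-cong K (λ j → ∑-cong K (λ j' → 𝟙-cong (shift m j ℤ.- shift m j' ℤ.≟ ℤ.+ r) (j ≟ j' + r)
                                                (shift-difference m j j' r) (λ { refl → shift-difference⁻ m j' r }))) ⟩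
  repsℕ K r  ∎
  where open ≡-Reasoning

repsNe≡reps : ∀ A r → repsNe A (ℤ.+ suc r) ≡ reps A (ℤ.+ suc r)
repsNe≡reps A r = begin
  repsNe A (ℤ.+ suc r)
    ≡⟨ length-filter≡∑𝟙 _ (pairs A) ⟩
  ∑[ p ∈ pairs A ] 𝟙 (distinct p ×-dec difference p)
    ≡⟨ ∑-cong (pairs A) (λ p → 𝟙-cong (distinct p ×-dec difference p) (difference p) proj₂ (distinct-if-positive p)) ⟩
  ∑[ p ∈ pairs A ] 𝟙 (difference p)
    ≡⟨ length-filter≡∑𝟙 _ (pairs A) ⟨
  reps A (ℤ.+ suc r)  ∎
  where
  open ≡-Reasoning
  distinct : ∀ (p : ℤ × ℤ) → Dec (proj₁ p ≢ proj₂ p)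
  distinct (a , b) = ¬? (a ℤ.≟ b)
  difference : ∀ (p : ℤ × ℤ) → Dec (proj₁ p ℤ.- proj₂ p ≡ ℤ.+ suc r)
  difference (a , b) = a ℤ.- b ℤ.≟ ℤ.+ suc r
  distinct-if-positive : ∀ p → proj₁ p ℤ.- proj₂ p ≡ ℤ.+ suc r → proj₁ p ≢ proj₂ p × proj₁ p ℤ.- proj₂ p ≡ ℤ.+ suc r
  distinct-if-positive (a , b) eq = (λ { refl → 0≢1+n (ℤP.+-injective (trans (sym (ℤP.+-inverseʳ a)) eq)) }) , eq

≤-by-difference : ∀ {x y x' y'} → y ℤ.- x ≡ y' ℤ.- x' → x ℤ.≤ y → x' ℤ.≤ y'
≤-by-difference eq x≤y = ℤP.0≤i-j⇒j≤i (subst (0ℤ ℤ.≤_) eq (ℤP.i≤j⇒0≤j-i x≤y))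

𝟙-window-shift : ∀ m T j k →
  𝟙 ((shift (m ℤ.+ ℤ.+ 1) k ℤ.- ℤ.+ T ℤ.≤? shift m j) ×-dec (shift m j ℤ.<? shift (m ℤ.+ ℤ.+ 1) k))
    ≡ between j (j + T) k
𝟙-window-shift m T j k = 𝟙-cong ((i ℤ.- ℤ.+ T ℤ.≤? shift m j) ×-dec (shift m j ℤ.<? i)) ((j ≤? k) ×-dec (k <? j + T))
  (λ (start≤ , <end) → <end⇒ <end , start≤⇒ start≤)
  (λ (j≤k , k<j+T) → start≤⇐ k<j+T , <end⇐ j≤k)
  where
  i : ℤ
  i = shift (m ℤ.+ ℤ.+ 1) k
  start-gap : ∀ m j k t → (m ℤ.+ j) ℤ.- ((m ℤ.+ ℤ.+ 1) ℤ.+ k ℤ.- t) ≡ (j ℤ.+ t) ℤ.- (ℤ.+ 1 ℤ.+ k)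
  start-gap = ℤ-solve-∀
  end-gap : ∀ m j k → (m ℤ.+ ℤ.+ 1) ℤ.+ k ℤ.- (ℤ.+ 1 ℤ.+ (m ℤ.+ j)) ≡ (ℤ.+ 1 ℤ.+ k) ℤ.- (ℤ.+ 1 ℤ.+ j)
  end-gap = ℤ-solve-∀
  start≤⇒ : i ℤ.- ℤ.+ T ℤ.≤ shift m j → k < j + T
  start≤⇒ = ℤP.drop‿+≤+ ∘ ≤-by-difference (start-gap m (ℤ.+ j) (ℤ.+ k) (ℤ.+ T))
  start≤⇐ : k < j + T → i ℤ.- ℤ.+ T ℤ.≤ shift m j
  start≤⇐ = ≤-by-difference (sym (start-gap m (ℤ.+ j) (ℤ.+ k) (ℤ.+ T))) ∘ ℤ.+≤+
  <end⇒ : shift m j ℤ.< i → j ≤ k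
  <end⇒ = ≤-pred ∘ ℤP.drop‿+≤+ ∘ ≤-by-difference (end-gap m (ℤ.+ j) (ℤ.+ k)) ∘ ℤP.i<j⇒suc[i]≤j
  <end⇐ : j ≤ k → shift m j ℤ.< i
  <end⇐ = ℤP.suc[i]≤j⇒i<j ∘ ≤-by-difference (sym (end-gap m (ℤ.+ j) (ℤ.+ k))) ∘ ℤ.+≤+ ∘ s≤s

countWin-shift : ∀ m T K k → countWin (map (shift m) K) (shift (m ℤ.+ ℤ.+ 1) k) T ≡ cover T K k
countWin-shift m T K k =
  trans (length-filter≡∑𝟙 _ (map (shift m) K)) (trans (∑-map K (shift m) _) (∑-cong K (λ j → 𝟙-window-shift m T j k)))

intervalℤ-shift : ∀ m T D → intervalℤ (m ℤ.+ ℤ.+ 1) (ℤ.+ T ℤ.+ shift m D) ≡ map (shift (m ℤ.+ ℤ.+ 1)) (upTo (T + D))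
intervalℤ-shift m T D = cong (λ z → map (shift (m ℤ.+ ℤ.+ 1)) (upTo (clamp z))) (length≡ m (ℤ.+ T) (ℤ.+ D))
  where
  length≡ : ∀ m t d → t ℤ.+ (m ℤ.+ d) ℤ.+ ℤ.+ 1 ℤ.- (m ℤ.+ ℤ.+ 1) ≡ t ℤ.+ d
  length≡ = ℤ-solve-∀

-- Rational arithmetic

ℚ-ring : ACR.AlmostCommutativeRing 0ℓ 0ℓ
ℚ-ring = ACR.fromCommutativeRing ℚP.+-*-commutativeRing (λ q → dec⇒maybe (0ℚ ℚP.≟ q))

module _ (p r : ℚᵘ) where

  fromℚᵘ-homo-+ : ℚ.fromℚᵘ (p ℚᵘ.+ r) ≡ ℚ.fromℚᵘ p ℚ.+ ℚ.fromℚᵘ r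
  fromℚᵘ-homo-+ = ℚP.toℚᵘ-injective (begin
    ℚ.toℚᵘ (ℚ.fromℚᵘ (p ℚᵘ.+ r))
      ≈⟨ ℚP.toℚᵘ-fromℚᵘ (p ℚᵘ.+ r) ⟩
    p ℚᵘ.+ r
      ≈⟨ ℚᵘP.+-cong (ℚᵘP.≃-sym (ℚP.toℚᵘ-fromℚᵘ p)) (ℚᵘP.≃-sym (ℚP.toℚᵘ-fromℚᵘ r)) ⟩
    ℚ.toℚᵘ (ℚ.fromℚᵘ p) ℚᵘ.+ ℚ.toℚᵘ (ℚ.fromℚᵘ r)
      ≈⟨ ℚᵘP.≃-sym (ℚP.toℚᵘ-homo-+ (ℚ.fromℚᵘ p) (ℚ.fromℚᵘ r)) ⟩
    ℚ.toℚᵘ (ℚ.fromℚᵘ p ℚ.+ ℚ.fromℚᵘ r)  ∎)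
    where open ℚᵘP.≃-Reasoning

  fromℚᵘ-homo-* : ℚ.fromℚᵘ (p ℚᵘ.* r) ≡ ℚ.fromℚᵘ p ℚ.* ℚ.fromℚᵘ r
  fromℚᵘ-homo-* = ℚP.toℚᵘ-injective (begin
    ℚ.toℚᵘ (ℚ.fromℚᵘ (p ℚᵘ.* r))
      ≈⟨ ℚP.toℚᵘ-fromℚᵘ (p ℚᵘ.* r) ⟩
    p ℚᵘ.* r
      ≈⟨ ℚᵘP.*-cong (ℚᵘP.≃-sym (ℚP.toℚᵘ-fromℚᵘ p)) (ℚᵘP.≃-sym (ℚP.toℚᵘ-fromℚᵘ r)) ⟩
    ℚ.toℚᵘ (ℚ.fromℚᵘ p) ℚᵘ.* ℚ.toℚᵘ (ℚ.fromℚᵘ r)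
      ≈⟨ ℚᵘP.≃-sym (ℚP.toℚᵘ-homo-* (ℚ.fromℚᵘ p) (ℚ.fromℚᵘ r)) ⟩
    ℚ.toℚᵘ (ℚ.fromℚᵘ p ℚ.* ℚ.fromℚᵘ r)  ∎)
    where open ℚᵘP.≃-Reasoning

mkℚᵘ-+ : ∀ i j → mkℚᵘ (i ℤ.+ j) 0 ℚᵘ.≃ mkℚᵘ i 0 ℚᵘ.+ mkℚᵘ j 0
mkℚᵘ-+ i j = *≡* (identity i j)
  where
  identity : ∀ i j → (i ℤ.+ j) ℤ.* ℤ.+ 1 ≡ (i ℤ.* ℤ.+ 1 ℤ.+ j ℤ.* ℤ.+ 1) ℤ.* ℤ.+ 1
  identity = ℤ-solve-∀

mkℚᵘ-* : ∀ i j → mkℚᵘ (i ℤ.* j) 0 ℚᵘ.≃ mkℚᵘ i 0 ℚᵘ.* mkℚᵘ j 0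
mkℚᵘ-* i j = *≡* refl

mkℚᵘ-*-cancel : ∀ i d → mkℚᵘ i d ℚᵘ.* mkℚᵘ (ℤ.+ suc d) 0 ℚᵘ.≃ mkℚᵘ i 0
mkℚᵘ-*-cancel i d = *≡* (trans (ℤP.*-identityʳ _) (cong (λ n → i ℤ.* ℤ.+ n) (sym (*-identityʳ (suc d)))))

ℕ→ℚ-+ : ∀ a b → ℕ→ℚ (a + b) ≡ ℕ→ℚ a ℚ.+ ℕ→ℚ b
ℕ→ℚ-+ a b = trans (ℚP.fromℚᵘ-cong (mkℚᵘ-+ (ℤ.+ a) (ℤ.+ b))) (fromℚᵘ-homo-+ (mkℚᵘ (ℤ.+ a) 0) (mkℚᵘ (ℤ.+ b) 0))

ℕ→ℚ-* : ∀ a b → ℕ→ℚ (a * b) ≡ ℕ→ℚ a ℚ.* ℕ→ℚ b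
ℕ→ℚ-* a b = begin
  ℚ.fromℚᵘ (mkℚᵘ (ℤ.+ (a * b)) 0)               ≡⟨ cong (λ i → ℚ.fromℚᵘ (mkℚᵘ i 0)) (ℤP.pos-* a b) ⟩
  ℚ.fromℚᵘ (mkℚᵘ (ℤ.+ a ℤ.* ℤ.+ b) 0)           ≡⟨ ℚP.fromℚᵘ-cong (mkℚᵘ-* (ℤ.+ a) (ℤ.+ b)) ⟩
  ℚ.fromℚᵘ (mkℚᵘ (ℤ.+ a) 0 ℚᵘ.* mkℚᵘ (ℤ.+ b) 0) ≡⟨ fromℚᵘ-homo-* (mkℚᵘ (ℤ.+ a) 0) (mkℚᵘ (ℤ.+ b) 0) ⟩
  ℕ→ℚ a ℚ.* ℕ→ℚ b                              ∎
  where open ≡-Reasoning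

divℕ-*-cancel : ∀ x d → divℕ (ℤ.+ x) (suc d) ℚ.* ℕ→ℚ (suc d) ≡ ℕ→ℚ x
divℕ-*-cancel x d = trans (sym (fromℚᵘ-homo-* (mkℚᵘ (ℤ.+ x) d) (mkℚᵘ (ℤ.+ suc d) 0)))
                          (ℚP.fromℚᵘ-cong (mkℚᵘ-*-cancel (ℤ.+ x) d))

sumℚ-squared-deviations : ∀ {X : Set} (μ : ℚ) (c : X → ℕ) (xs : List X) →
  sumℚ (map (λ x → (ℕ→ℚ (c x) ℚ.- μ) ℚ.* (ℕ→ℚ (c x) ℚ.- μ)) xs)
    ≡ ℕ→ℚ (∑[ x ∈ xs ] (c x * c x)) ℚ.- (μ ℚ.+ μ) ℚ.* ℕ→ℚ (∑ xs c) ℚ.+ ℕ→ℚ (length xs) ℚ.* (μ ℚ.* μ)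
sumℚ-squared-deviations μ c [] = expand μ
  where
  expand : ∀ μ → 0ℚ ≡ 0ℚ ℚ.- (μ ℚ.+ μ) ℚ.* 0ℚ ℚ.+ 0ℚ ℚ.* (μ ℚ.* μ)
  expand = ring-solve-∀ ℚ-ring
sumℚ-squared-deviations μ c (x ∷ xs) = begin
  (y ℚ.- μ) ℚ.* (y ℚ.- μ) ℚ.+ sumℚ (map (λ x → (ℕ→ℚ (c x) ℚ.- μ) ℚ.* (ℕ→ℚ (c x) ℚ.- μ)) xs)
    ≡⟨ cong ((y ℚ.- μ) ℚ.* (y ℚ.- μ) ℚ.+_) (sumℚ-squared-deviations μ c xs) ⟩
  (y ℚ.- μ) ℚ.* (y ℚ.- μ) ℚ.+ (Q ℚ.- (μ ℚ.+ μ) ℚ.* S ℚ.+ n ℚ.* (μ ℚ.* μ))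
    ≡⟨ expand y μ Q S n ⟩
  (y ℚ.* y ℚ.+ Q) ℚ.- (μ ℚ.+ μ) ℚ.* (y ℚ.+ S) ℚ.+ (1ℚ ℚ.+ n) ℚ.* (μ ℚ.* μ)
    ≡⟨ cong₂ (λ q s → q ℚ.- (μ ℚ.+ μ) ℚ.* s ℚ.+ (1ℚ ℚ.+ n) ℚ.* (μ ℚ.* μ))
             (trans (cong (ℚ._+ Q) (sym (ℕ→ℚ-* (c x) (c x)))) (sym (ℕ→ℚ-+ (c x * c x) _)))
             (sym (ℕ→ℚ-+ (c x) _)) ⟩
  ℕ→ℚ (∑[ x ∈ x ∷ xs ] (c x * c x)) ℚ.- (μ ℚ.+ μ) ℚ.* ℕ→ℚ (∑ (x ∷ xs) c) ℚ.+ (1ℚ ℚ.+ n) ℚ.* (μ ℚ.* μ)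
    ≡⟨ cong (λ l → ℕ→ℚ (∑[ x ∈ x ∷ xs ] (c x * c x)) ℚ.- (μ ℚ.+ μ) ℚ.* ℕ→ℚ (∑ (x ∷ xs) c) ℚ.+ l ℚ.* (μ ℚ.* μ))
            (sym (ℕ→ℚ-+ 1 (length xs))) ⟩
  ℕ→ℚ (∑[ x ∈ x ∷ xs ] (c x * c x)) ℚ.- (μ ℚ.+ μ) ℚ.* ℕ→ℚ (∑ (x ∷ xs) c) ℚ.+ ℕ→ℚ (suc (length xs)) ℚ.* (μ ℚ.* μ)  ∎
  where
  open ≡-Reasoning
  y Q S n : ℚ
  y = ℕ→ℚ (c x)
  Q = ℕ→ℚ (∑[ x ∈ xs ] (c x * c x))
  S = ℕ→ℚ (∑ xs c)
  n = ℕ→ℚ (length xs)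
  expand : ∀ y μ Q S n → (y ℚ.- μ) ℚ.* (y ℚ.- μ) ℚ.+ (Q ℚ.- (μ ℚ.+ μ) ℚ.* S ℚ.+ n ℚ.* (μ ℚ.* μ))
                         ≡ (y ℚ.* y ℚ.+ Q) ℚ.- (μ ℚ.+ μ) ℚ.* (y ℚ.+ S) ℚ.+ (1ℚ ℚ.+ n) ℚ.* (μ ℚ.* μ)
  expand = ring-solve-∀ ℚ-ring

÷-by-mean : ∀ {μ a l den : ℚ} → μ ℚ.* l ≡ a → den ≡ μ ℚ.* a → .{{_ : ℚ.NonZero den}} → ℚ._÷_ (a ℚ.* a) den ≡ l
÷-by-mean {μ} {l = l} refl refl = begin
  (μ ℚ.* l) ℚ.* (μ ℚ.* l) ℚ.* ℚ.1/ x  ≡⟨ regroup μ l (ℚ.1/ x) ⟩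
  l ℚ.* (x ℚ.* ℚ.1/ x)                ≡⟨ cong (l ℚ.*_) (ℚP.*-inverseʳ x) ⟩
  l ℚ.* 1ℚ                            ≡⟨ ℚP.*-identityʳ l ⟩
  l                                   ∎
  where
  open ≡-Reasoning
  x : ℚ
  x = μ ℚ.* (μ ℚ.* l)
  regroup : ∀ μ l z → (μ ℚ.* l) ℚ.* (μ ℚ.* l) ℚ.* z ≡ l ℚ.* (μ ℚ.* (μ ℚ.* l) ℚ.* z)
  regroup = ring-solve-∀ ℚ-ring

ℕ→ℚ-+-∸ : ∀ t d → ℕ→ℚ (t + d) ℚ.- ℕ→ℚ t ≡ ℕ→ℚ d
ℕ→ℚ-+-∸ t d = trans (cong (ℚ._- ℕ→ℚ t) (ℕ→ℚ-+ t d)) (cancel (ℕ→ℚ t) (ℕ→ℚ d))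
  where
  cancel : ∀ t d → t ℚ.+ d ℚ.- t ≡ d
  cancel = ring-solve-∀ ℚ-ring

ℕ→ℚ-square : ∀ n t → ℕ→ℚ (n * t) ℚ.* ℕ→ℚ (n * t) ≡ ℕ→ℚ (n * n * t * t)
ℕ→ℚ-square n t = trans (sym (ℕ→ℚ-* (n * t) (n * t))) (cong ℕ→ℚ (rearrange n t))
  where
  rearrange : ∀ n t → n * t * (n * t) ≡ n * n * t * t
  rearrange = solve-∀

Sg-as-∑ : ∀ g A T → Sg g A T ≡ ∑[ r ∈ range1 T ] ((g ∸ reps A (ℤ.+ r)) * (T ∸ r))
Sg-as-∑ g A T = trans (∑-by-value g ρ (range1 T) (λ s r → (g ∸ s) * (T ∸ r)))
                      (∑-cong (range1 T) (λ r → trans (sym (*-assoc (𝟙 (ρ r <? g)) _ _)) (cong (_* (T ∸ r)) (𝟙<*∸ (ρ r) g))))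
  where
  ρ : ℕ → ℕ
  ρ r = reps A (ℤ.+ r)

mean : List ℤ → ℕ → ℚ
mean A T = divℕ (ℤ.+ (length A * T)) (T + clamp (diam A))

module _ (A : List ℤ) (N : ℕ) where

  private
    T D : ℕ
    T = suc N
    D = clamp (diam A)
    K : List ℕ
    K = offsets A
    μ : ℚ
    μ = mean A T

    length-K : length K ≡ length A
    length-K = length-map _ A

    reps≡repsℕ : ∀ r → reps A (ℤ.+ r) ≡ repsℕ K r
    reps≡repsℕ r = trans (cong (λ B → reps B (ℤ.+ r)) (sym (map-shift-offsets A))) (reps-shift (minℤ A) K r)

    countWin≡cover : ∀ k → countWin A (shift (minℤ A ℤ.+ ℤ.+ 1) k) T ≡ cover T K k
    countWin≡cover k = trans (cong (λ B → countWin B (shift (minℤ A ℤ.+ ℤ.+ 1) k) T) (sym (map-shift-offsets A)))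
                             (countWin-shift (minℤ A) T K k)

  second-moment-Sg : ∀ g → Unique A → IsThinSidon g A →
    2 * Sg g A T + ∑[ k ∈ upTo (T + D) ] (cover T K k * cover T K k) ≡ g * T * N + length A * T
  second-moment-Sg g unique thin = begin
    2 * Sg g A T + C
      ≡⟨ cong (λ s → 2 * s + C) (Sg-as-∑ g A T) ⟩
    2 * ∑[ r ∈ range1 T ] ((g ∸ reps A (ℤ.+ r)) * (T ∸ r)) + C
      ≡⟨ cong (λ s → 2 * s + C) (∑-cong (range1 T) (λ r → cong (λ ρ → (g ∸ ρ) * (T ∸ r)) (reps≡repsℕ r))) ⟩
    2 * ∑[ r ∈ range1 T ] ((g ∸ repsℕ K r) * (T ∸ r)) + C
      ≡⟨ second-moment g N D (offsets-≤-diam A) unique-K repsℕ≤g ⟩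
    g * T * N + length K * T
      ≡⟨ cong (λ n → g * T * N + n * T) length-K ⟩
    g * T * N + length A * T  ∎
    where
    open ≡-Reasoning
    C : ℕ
    C = ∑[ k ∈ upTo (T + D) ] (cover T K k * cover T K k)
    unique-K : Unique K
    unique-K = UP.map⁻ (subst Unique (sym (map-shift-offsets A)) unique)
    repsℕ≤g : ∀ {r} → r ∈ range1 T → repsℕ K r ≤ g
    repsℕ≤g r∈ with ∈-map⁻ suc r∈
    ... | k , _ , refl = subst (_≤ g) (trans (repsNe≡reps A k) (reps≡repsℕ (suc k))) (thin (ℤ.+ suc k))

  V-as-second-moment : V A T ≡ ℕ→ℚ (∑[ k ∈ upTo (T + D) ] (cover T K k * cover T K k))
                                ℚ.- (μ ℚ.+ μ) ℚ.* ℕ→ℚ (length A * T) ℚ.+ ℕ→ℚ (T + D) ℚ.* (μ ℚ.* μ)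
  V-as-second-moment = begin
    sumℚ (map deviation² (intervalℤ (minℤ A ℤ.+ ℤ.+ 1) (ℤ.+ T ℤ.+ maxℤ A)))
      ≡⟨ cong (λ M → sumℚ (map deviation² (intervalℤ (minℤ A ℤ.+ ℤ.+ 1) (ℤ.+ T ℤ.+ M)))) (maxℤ≡shift-diam A) ⟩
    sumℚ (map deviation² (intervalℤ (minℤ A ℤ.+ ℤ.+ 1) (ℤ.+ T ℤ.+ shift (minℤ A) D)))
      ≡⟨ cong (λ is → sumℚ (map deviation² is)) (intervalℤ-shift (minℤ A) T D) ⟩
    sumℚ (map deviation² (map (shift (minℤ A ℤ.+ ℤ.+ 1)) (upTo (T + D))))
      ≡⟨ cong sumℚ (sym (map-∘ {g = deviation²} {f = shift (minℤ A ℤ.+ ℤ.+ 1)} (upTo (T + D)))) ⟩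
    sumℚ (map (λ k → deviation² (shift (minℤ A ℤ.+ ℤ.+ 1) k)) (upTo (T + D)))
      ≡⟨ cong sumℚ (map-cong (λ k → cong (λ c → (ℕ→ℚ c ℚ.- μ) ℚ.* (ℕ→ℚ c ℚ.- μ)) (countWin≡cover k)) (upTo (T + D))) ⟩
    sumℚ (map (λ k → (ℕ→ℚ (cover T K k) ℚ.- μ) ℚ.* (ℕ→ℚ (cover T K k) ℚ.- μ)) (upTo (T + D)))
      ≡⟨ sumℚ-squared-deviations μ (cover T K) (upTo (T + D)) ⟩
    ℕ→ℚ C ℚ.- (μ ℚ.+ μ) ℚ.* ℕ→ℚ (∑ (upTo (T + D)) (cover T K)) ℚ.+ ℕ→ℚ (length (upTo (T + D))) ℚ.* (μ ℚ.* μ)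
      ≡⟨ cong₂ (λ s l → ℕ→ℚ C ℚ.- (μ ℚ.+ μ) ℚ.* ℕ→ℚ s ℚ.+ ℕ→ℚ l ℚ.* (μ ℚ.* μ))
               (trans (∑-cover T D (offsets-≤-diam A)) (cong (_* T) length-K)) (length-upTo (T + D)) ⟩
    ℕ→ℚ C ℚ.- (μ ℚ.+ μ) ℚ.* ℕ→ℚ (length A * T) ℚ.+ ℕ→ℚ (T + D) ℚ.* (μ ℚ.* μ)  ∎
    where
    open ≡-Reasoning
    C : ℕ
    C = ∑[ k ∈ upTo (T + D) ] (cover T K k * cover T K k)
    deviation² : ℤ → ℚ
    deviation² i = (ℕ→ℚ (countWin A i T) ℚ.- μ) ℚ.* (ℕ→ℚ (countWin A i T) ℚ.- μ)

  denom≡mean*size : ∀ g → Unique A → IsThinSidon g A → denom g A T ≡ μ ℚ.* ℕ→ℚ (length A * T)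
  denom≡mean*size g unique thin = begin
    ℕ→ℚ (g * T * N + n * T) ℚ.- (ℕ→ℚ (2 * Sg g A T) ℚ.+ V A T)
      ≡⟨ cong₂ (λ e v → ℕ→ℚ e ℚ.- (ℕ→ℚ (2 * Sg g A T) ℚ.+ v)) (sym (second-moment-Sg g unique thin)) V-as-second-moment ⟩
    ℕ→ℚ (2 * Sg g A T + C) ℚ.- (ℕ→ℚ (2 * Sg g A T) ℚ.+ (ℕ→ℚ C ℚ.- (μ ℚ.+ μ) ℚ.* a ℚ.+ l ℚ.* (μ ℚ.* μ)))
      ≡⟨ cong (ℚ._- (ℕ→ℚ (2 * Sg g A T) ℚ.+ (ℕ→ℚ C ℚ.- (μ ℚ.+ μ) ℚ.* a ℚ.+ l ℚ.* (μ ℚ.* μ)))) (ℕ→ℚ-+ (2 * Sg g A T) C) ⟩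
    (ℕ→ℚ (2 * Sg g A T) ℚ.+ ℕ→ℚ C) ℚ.- (ℕ→ℚ (2 * Sg g A T) ℚ.+ (ℕ→ℚ C ℚ.- (μ ℚ.+ μ) ℚ.* a ℚ.+ l ℚ.* (μ ℚ.* μ)))
      ≡⟨ cancel (ℕ→ℚ (2 * Sg g A T)) (ℕ→ℚ C) μ a l ⟩
    (μ ℚ.+ μ) ℚ.* a ℚ.- (μ ℚ.* l) ℚ.* μ
      ≡⟨ cong (λ z → (μ ℚ.+ μ) ℚ.* a ℚ.- z ℚ.* μ) (divℕ-*-cancel (n * T) (N + D)) ⟩
    (μ ℚ.+ μ) ℚ.* a ℚ.- a ℚ.* μ
      ≡⟨ collect μ a ⟩
    μ ℚ.* a  ∎
    where
    open ≡-Reasoning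
    n : ℕ
    n = length A
    a l : ℚ
    a = ℕ→ℚ (n * T)
    l = ℕ→ℚ (T + D)
    C : ℕ
    C = ∑[ k ∈ upTo (T + D) ] (cover T K k * cover T K k)
    cancel : ∀ s c μ a l → (s ℚ.+ c) ℚ.- (s ℚ.+ (c ℚ.- (μ ℚ.+ μ) ℚ.* a ℚ.+ l ℚ.* (μ ℚ.* μ)))
                           ≡ (μ ℚ.+ μ) ℚ.* a ℚ.- (μ ℚ.* l) ℚ.* μ
    cancel = ring-solve-∀ ℚ-ring
    collect : ∀ μ a → (μ ℚ.+ μ) ℚ.* a ℚ.- a ℚ.* μ ≡ μ ℚ.* a
    collect = ring-solve-∀ ℚ-ring

diam≡ℕ→ℚ : ∀ A → diam A ℚ./ 1 ≡ ℕ→ℚ (clamp (diam A))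
diam≡ℕ→ℚ A = cong (ℚ._/ 1) (sym (clamp-nonNeg (ℤP.i≤j⇒0≤j-i (minℤ≤maxℤ A))))

mean*size-positive : ∀ x xs N → ℚ.Positive (mean (x ∷ xs) (suc N) ℚ.* ℕ→ℚ (length (x ∷ xs) * suc N))
mean*size-positive x xs N =
  ℚP.pos*pos⇒pos (mean (x ∷ xs) (suc N)) {{ℚP.normalize-pos (n * suc N) (suc N + clamp (diam (x ∷ xs)))}}
                 (ℕ→ℚ (n * suc N)) {{ℚP.normalize-pos (n * suc N) 1}}
  where
  n : ℕ
  n = length (x ∷ xs)

theorem4 : (g : ℕ) → 0 ℕ.< g → (A : List ℤ) → Unique A → A ≢ [] → IsThinSidon g A →
  (T : ℕ) → 0 ℕ.< T →
  Σ[ nz ∈ ℚ.NonZero (denom g A T) ]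
    ((diam A ℚ./ 1) ≡ ℚ._÷_ (ℕ→ℚ (length A ℕ.* length A ℕ.* T ℕ.* T)) (denom g A T) {{nz}} ℚ.- ℕ→ℚ T)
theorem4 g _ [] _ A≢[] _ _ _ = ⊥-elim (A≢[] refl)
theorem4 g _ A@(x ∷ xs) unique _ thin (suc N) _ = denom≢0 , diam≡
  where
  T n D : ℕ
  T = suc N
  n = length A
  D = clamp (diam A)
  denom≡ : denom g A T ≡ mean A T ℚ.* ℕ→ℚ (n * T)
  denom≡ = denom≡mean*size A N g unique thin
  denom≢0 : ℚ.NonZero (denom g A T)
  denom≢0 = subst ℚ.NonZero (sym denom≡) (ℚP.pos⇒nonZero (mean A T ℚ.* ℕ→ℚ (n * T)) {{mean*size-positive x xs N}})
  diam≡ : diam A ℚ./ 1 ≡ ℚ._÷_ (ℕ→ℚ (n * n * T * T)) (denom g A T) {{denom≢0}} ℚ.- ℕ→ℚ T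
  diam≡ = begin
    diam A ℚ./ 1
      ≡⟨ diam≡ℕ→ℚ A ⟩
    ℕ→ℚ D
      ≡⟨ ℕ→ℚ-+-∸ T D ⟨
    ℕ→ℚ (T + D) ℚ.- ℕ→ℚ T
      ≡⟨ cong (ℚ._- ℕ→ℚ T) (÷-by-mean {mean A T} (divℕ-*-cancel (n * T) (N + D)) denom≡ {{denom≢0}}) ⟨
    ℚ._÷_ (ℕ→ℚ (n * T) ℚ.* ℕ→ℚ (n * T)) (denom g A T) {{denom≢0}} ℚ.- ℕ→ℚ T
      ≡⟨ cong (λ z → ℚ._÷_ z (denom g A T) {{denom≢0}} ℚ.- ℕ→ℚ T) (ℕ→ℚ-square n T) ⟩
    ℚ._÷_ (ℕ→ℚ (n * n * T * T)) (denom g A T) {{denom≢0}} ℚ.- ℕ→ℚ T  ∎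
    where open ≡-Reasoning
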